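{- Let $(a_n)_{n\ge 0}$ be a sequence of real numbers with $a_0=1$, and let $(f_n(x))_{n\ge0}$ be the Appell polynomials defined by $\sum_{n\ge0} f_n(x)\frac{t^n}{n!}=F(t)e^{xt}$, where $F(t)=1+\sum_{n\ge1}a_n\frac{t^n}{n!}$ (equivalently $f_n(x)=\sum_{j=0}^n\binom{n}{j}a_jx^{n-j}$). Let $n,m,p$ be non-negative integers with $p\le\min(n,m)$. Then for all real $x,y$, $$\sum_{k=0}^{n}\binom{n}{k}\binom{m+k}{p}y^{n-k}f_{m-p+k}(x)=\sum_{k=0}^{m}\binom{m}{k}\binom{n+k}{p}(-y)^{m-k}f_{n-p+k}(x+y).$$
   Context: Generating functions are formal power series in $t$. -}

module Defs where

open import Level using (Level)
open import Data.Nat using (ℕ; zero; suc; _∸_)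
open import Data.Nat.Combinatorics using (_C_)
open import Algebra.Bundles using (CommutativeRing; Semiring)
import Algebra.Definitions.RawSemiring as RS

module _ {c ℓ : Level} (R : CommutativeRing c ℓ) where
  open CommutativeRing R using (Carrier; _+_; _*_; 1#; semiring)
  open RS (Semiring.rawSemiring semiring) using (_×_; _^_)

  Σ≤ : ℕ → (ℕ → Carrier) → Carrier
  Σ≤ zero    g = g zero
  Σ≤ (suc n) g = Σ≤ n g + g (suc n)

  binom : ℕ → ℕ → Carrier
  binom n k = (n C k) × 1#

  pow : Carrier → ℕ → Carrier
  pow x n = x ^ n

  appell : (ℕ → Carrier) → ℕ → Carrier → Carrier
  appell a n x = Σ≤ n (λ j → binom n j * a j * pow x (n ∸ j))

-- Expanding f_(m-p+k)(x) = Σ_j C(m-p+k,j) a_j x^(m-p+k-j) and using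
-- C(N,p) C(N-p,j) = C(p+j,p) C(N,p+j), the coefficient of a_j on either side is
-- C(p+j,p) times the same identity for the monomial sequence f_N(x) = x^N, with p + j
-- in place of p. For monomials, Pascal's rule in n shows that the left-hand side
-- M(n,m) (parameters y, x) satisfies M(n+1,m) = y M(n,m) + M(n,m+1), while the
-- right-hand side, which is M(m,n) with parameters -y, x+y, satisfies the same recurrence
-- with -y in place of y; the two y-terms cancel. Induction on n leaves n = 0, which is
-- the binomial theorem Σ_k C(m,k) C(k,p) (-y)^(m-k) (x+y)^(k-p) = C(m,p) x^(m-p).
module Submission where

open import Level using (Level)
open import Data.Nat using (ℕ; zero; suc; _+_; _∸_; _≤_; _<_; _≤′_; ≤′-reflexive; ≤′-step; _⊓_; _≤?_; z≤n; s≤s)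
import Data.Nat as ℕ
import Data.Nat.Properties as ℕₚ
open import Data.Nat.Combinatorics using (_C_; k>n⇒nCk≡0; nCk≡n!/k![n-k]!; k![n∸k]!∣n!; nCk+nC[k+1]≡[n+1]C[k+1])
open import Relation.Binary.PropositionalEquality as ≡ using (_≡_)
open import Relation.Nullary using (yes; no)
open import Function using (_∘_)
open import Algebra.Bundles using (CommutativeRing; Semiring)
open import Defs

module _ where
  open import Data.Nat using (_*_; _!)
  open import Data.Nat.Properties
  open import Data.Nat.DivMod using (m/n*n≡m)
  open import Data.Nat.Solver using (module +-*-Solver)
  open +-*-Solver
  open ≡.≡-Reasoning

  nCk*[k!*[n∸k]!]≡n! : ∀ {n k} → k ≤ n → (n C k) * (k ! * (n ∸ k) !) ≡ n !
  nCk*[k!*[n∸k]!]≡n! {n} {k} k≤n =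
    ≡.trans (≡.cong (_* (k ! * (n ∸ k) !)) (nCk≡n!/k![n-k]! k≤n)) (m/n*n≡m (k![n∸k]!∣n! k≤n))
    where instance _ = k !* (n ∸ k) !≢0

  n<p+j⇒nCp*[n∸p]Cj≡0 : ∀ n p j → n < p + j → (n C p) * ((n ∸ p) C j) ≡ 0
  n<p+j⇒nCp*[n∸p]Cj≡0 n p j n<p+j with p ≤? n
  ... | no p≰n  = ≡.cong (_* ((n ∸ p) C j)) (k>n⇒nCk≡0 (≰⇒> p≰n))
  ... | yes p≤n = ≡.trans (≡.cong ((n C p) *_) (k>n⇒nCk≡0 n∸p<j)) (*-zeroʳ (n C p))
    where
    n∸p<j : n ∸ p < j
    n∸p<j = ≡.subst (n ∸ p <_) (m+n∸m≡n p j) (∸-monoˡ-< n<p+j p≤n)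

  nCp*[n∸p]Cj≡[p+j]Cp*nC[p+j] : ∀ n p j → (n C p) * ((n ∸ p) C j) ≡ ((p + j) C p) * (n C (p + j))
  nCp*[n∸p]Cj≡[p+j]Cp*nC[p+j] n p j with p + j ≤? n
  ... | yes p+j≤n = *-cancelʳ-≡ _ _ (p ! * (j ! * (n ∸ (p + j)) !)) (≡.trans lhs (≡.sym rhs))
    where
    instance
      _ = m*n≢0 (p !) (j ! * (n ∸ (p + j)) !) {{p !≢0}} {{m*n≢0 _ _ {{j !≢0}} {{(n ∸ (p + j)) !≢0}}}}
    p≤n : p ≤ n
    p≤n = ≤-trans (m≤m+n p j) p+j≤n
    j≤n∸p : j ≤ n ∸ p
    j≤n∸p = ≡.subst (_≤ n ∸ p) (m+n∸m≡n p j) (∸-monoˡ-≤ p p+j≤n)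
    lhs : (n C p) * ((n ∸ p) C j) * (p ! * (j ! * (n ∸ (p + j)) !)) ≡ n !
    lhs = begin
      (n C p) * ((n ∸ p) C j) * (p ! * (j ! * (n ∸ (p + j)) !))
        ≡⟨ solve 5 (λ a b x y z → a :* b :* (x :* (y :* z)) := a :* (x :* (b :* (y :* z)))) ≡.refl
                 (n C p) ((n ∸ p) C j) (p !) (j !) ((n ∸ (p + j)) !) ⟩
      (n C p) * (p ! * (((n ∸ p) C j) * (j ! * (n ∸ (p + j)) !)))
        ≡⟨ ≡.cong (λ t → (n C p) * (p ! * (((n ∸ p) C j) * (j ! * t !)))) (∸-+-assoc n p j) ⟨
      (n C p) * (p ! * (((n ∸ p) C j) * (j ! * (n ∸ p ∸ j) !)))
        ≡⟨ ≡.cong (λ t → (n C p) * (p ! * t)) (nCk*[k!*[n∸k]!]≡n! j≤n∸p) ⟩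
      (n C p) * (p ! * (n ∸ p) !)
        ≡⟨ nCk*[k!*[n∸k]!]≡n! p≤n ⟩
      n ! ∎
    rhs : ((p + j) C p) * (n C (p + j)) * (p ! * (j ! * (n ∸ (p + j)) !)) ≡ n !
    rhs = begin
      ((p + j) C p) * (n C (p + j)) * (p ! * (j ! * (n ∸ (p + j)) !))
        ≡⟨ solve 5 (λ a b x y z → a :* b :* (x :* (y :* z)) := b :* ((a :* (x :* y)) :* z)) ≡.refl
                 ((p + j) C p) (n C (p + j)) (p !) (j !) ((n ∸ (p + j)) !) ⟩
      (n C (p + j)) * (((p + j) C p) * (p ! * j !) * (n ∸ (p + j)) !)
        ≡⟨ ≡.cong (λ t → (n C (p + j)) * (((p + j) C p) * (p ! * t !) * (n ∸ (p + j)) !)) (m+n∸m≡n p j) ⟨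
      (n C (p + j)) * (((p + j) C p) * (p ! * (p + j ∸ p) !) * (n ∸ (p + j)) !)
        ≡⟨ ≡.cong (λ t → (n C (p + j)) * (t * (n ∸ (p + j)) !)) (nCk*[k!*[n∸k]!]≡n! (m≤m+n p j)) ⟩
      (n C (p + j)) * ((p + j) ! * (n ∸ (p + j)) !)
        ≡⟨ nCk*[k!*[n∸k]!]≡n! p+j≤n ⟩
      n ! ∎
  ... | no p+j≰n = begin
    (n C p) * ((n ∸ p) C j)          ≡⟨ n<p+j⇒nCp*[n∸p]Cj≡0 n p j (≰⇒> p+j≰n) ⟩
    0                                ≡⟨ *-zeroʳ ((p + j) C p) ⟨
    ((p + j) C p) * 0                ≡⟨ ≡.cong (((p + j) C p) *_) (k>n⇒nCk≡0 (≰⇒> p+j≰n)) ⟨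
    ((p + j) C p) * (n C (p + j))    ∎

module BinomialSums {c ℓ : Level} (R : CommutativeRing c ℓ) where
  open CommutativeRing R renaming (_+_ to _+R_)
  open import Data.Nat.Properties using (≤-refl; m≤n⇒m≤1+n; n≤1+n; ≤⇒≤′; ≤′⇒≤; ≰⇒>; +-∸-assoc; +-suc; +-∸-comm; ∸-+-assoc; +-mono-≤; m∸n≤m)
  open import Algebra.Definitions.RawSemiring (Semiring.rawSemiring semiring) using (_×_; _^_)
  open import Algebra.Properties.Semiring.Exp semiring using (^-congˡ; ^-congʳ)
  open import Algebra.Properties.Semiring.Mult semiring using (×1-homo-*)
  open import Algebra.Properties.Monoid.Mult +-monoid using (×-homo-+)
  open import Algebra.Properties.CommutativeSemigroup +-commutativeSemigroup using (interchange)
  open import Algebra.Properties.CommutativeSemigroup *-commutativeSemigroup using (x∙yz≈y∙xz)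
  open import Algebra.Solver.Ring.NaturalCoefficients.Default commutativeSemiring
  open import Relation.Binary.Reasoning.Setoid setoid

  Σ≤-cong : ∀ n {f g : ℕ → Carrier} → (∀ {k} → k ≤ n → f k ≈ g k) → Σ≤ R n f ≈ Σ≤ R n g
  Σ≤-cong zero    f≈g = f≈g z≤n
  Σ≤-cong (suc n) f≈g = +-cong (Σ≤-cong n (f≈g ∘ m≤n⇒m≤1+n)) (f≈g ≤-refl)

  Σ≤-cong′ : ∀ n {f g : ℕ → Carrier} → (∀ k → f k ≈ g k) → Σ≤ R n f ≈ Σ≤ R n g
  Σ≤-cong′ n f≈g = Σ≤-cong n (λ {k} _ → f≈g k)

  Σ≤-distrib-+ : ∀ n (f g : ℕ → Carrier) → Σ≤ R n (λ k → f k +R g k) ≈ Σ≤ R n f +R Σ≤ R n g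
  Σ≤-distrib-+ zero    f g = refl
  Σ≤-distrib-+ (suc n) f g = trans (+-congʳ (Σ≤-distrib-+ n f g)) (interchange _ _ _ _)

  *-distribˡ-Σ≤ : ∀ n x (f : ℕ → Carrier) → x * Σ≤ R n f ≈ Σ≤ R n (λ k → x * f k)
  *-distribˡ-Σ≤ zero    x f = refl
  *-distribˡ-Σ≤ (suc n) x f = trans (distribˡ x _ _) (+-congʳ (*-distribˡ-Σ≤ n x f))

  Σ≤-comm : ∀ m n (h : ℕ → ℕ → Carrier) →
            Σ≤ R m (λ i → Σ≤ R n (h i)) ≈ Σ≤ R n (λ j → Σ≤ R m (λ i → h i j))
  Σ≤-comm zero    n h = refl
  Σ≤-comm (suc m) n h = trans (+-congʳ (Σ≤-comm m n h)) (sym (Σ≤-distrib-+ n _ (h (suc m))))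

  Σ≤-suc-head : ∀ n (f : ℕ → Carrier) → Σ≤ R (suc n) f ≈ f 0 +R Σ≤ R n (f ∘ suc)
  Σ≤-suc-head zero    f = refl
  Σ≤-suc-head (suc n) f = trans (+-congʳ (Σ≤-suc-head n f)) (+-assoc _ _ _)

  Σ≤-pad : ∀ {n} N (f : ℕ → Carrier) → n ≤ N → (∀ {k} → n < k → f k ≈ 0#) → Σ≤ R n f ≈ Σ≤ R N f
  Σ≤-pad {n} N f n≤N f≈0 = pad (≤⇒≤′ n≤N)
    where
    pad : ∀ {M} → n ≤′ M → Σ≤ R n f ≈ Σ≤ R M f
    pad (≤′-reflexive ≡.refl) = refl
    pad {suc M} (≤′-step n≤′M) = begin
      Σ≤ R n f         ≈⟨ pad n≤′M ⟩
      Σ≤ R M f         ≈⟨ +-identityʳ _ ⟨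
      Σ≤ R M f +R 0#   ≈⟨ +-congˡ (f≈0 (s≤s (≤′⇒≤ n≤′M))) ⟨
      Σ≤ R (suc M) f   ∎

  infix 8 _Cᴿ_
  _Cᴿ_ : ℕ → ℕ → Carrier
  _Cᴿ_ = binom R

  k>n⇒nCᴿk≈0 : ∀ {n k} → n < k → n Cᴿ k ≈ 0#
  k>n⇒nCᴿk≈0 n<k = reflexive (≡.cong (_× 1#) (k>n⇒nCk≡0 n<k))

  nCᴿk+nCᴿ[k+1]≈[n+1]Cᴿ[k+1] : ∀ n k → n Cᴿ k +R n Cᴿ suc k ≈ suc n Cᴿ suc k
  nCᴿk+nCᴿ[k+1]≈[n+1]Cᴿ[k+1] n k =
    trans (sym (×-homo-+ 1# (n C k) (n C suc k))) (reflexive (≡.cong (_× 1#) (nCk+nC[k+1]≡[n+1]C[k+1] n k)))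

  nCᴿp*[n∸p]Cᴿj≈[p+j]Cᴿp*nCᴿ[p+j] : ∀ n p j → n Cᴿ p * (n ∸ p) Cᴿ j ≈ (p + j) Cᴿ p * n Cᴿ (p + j)
  nCᴿp*[n∸p]Cᴿj≈[p+j]Cᴿp*nCᴿ[p+j] n p j = begin
    n Cᴿ p * (n ∸ p) Cᴿ j                     ≈⟨ ×1-homo-* (n C p) ((n ∸ p) C j) ⟨
    ((n C p) ℕ.* ((n ∸ p) C j)) × 1#           ≡⟨ ≡.cong (_× 1#) (nCp*[n∸p]Cj≡[p+j]Cp*nC[p+j] n p j) ⟩
    (((p + j) C p) ℕ.* (n C (p + j))) × 1#     ≈⟨ ×1-homo-* ((p + j) C p) (n C (p + j)) ⟩
    (p + j) Cᴿ p * n Cᴿ (p + j)               ∎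

  nCᴿk*[w*w^[n∸k]]≈nCᴿk*w^[1+n∸k] : ∀ n k w → n Cᴿ k * (w * w ^ (n ∸ k)) ≈ n Cᴿ k * w ^ (suc n ∸ k)
  nCᴿk*[w*w^[n∸k]]≈nCᴿk*w^[1+n∸k] n k w with k ≤? n
  ... | yes k≤n = *-congˡ (^-congʳ w (≡.sym (+-∸-assoc 1 k≤n)))
  ... | no k≰n  = trans (*-congʳ nCᴿk≈0) (trans (zeroˡ _) (sym (trans (*-congʳ nCᴿk≈0) (zeroˡ _))))
    where
    nCᴿk≈0 : n Cᴿ k ≈ 0#
    nCᴿk≈0 = k>n⇒nCᴿk≈0 (≰⇒> k≰n)

  Σ≤-pascal : ∀ n (h : ℕ → Carrier) →
              Σ≤ R (suc n) (λ k → suc n Cᴿ k * h k)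
              ≈ Σ≤ R n (λ k → n Cᴿ k * h k) +R Σ≤ R n (λ k → n Cᴿ k * h (suc k))
  Σ≤-pascal n h = begin
    Σ≤ R (suc n) (λ k → suc n Cᴿ k * h k)
      ≈⟨ Σ≤-suc-head n _ ⟩
    n Cᴿ 0 * h 0 +R Σ≤ R n (λ k → suc n Cᴿ suc k * h (suc k))
      ≈⟨ +-congˡ (Σ≤-cong′ n (λ k → trans (*-congʳ (sym (nCᴿk+nCᴿ[k+1]≈[n+1]Cᴿ[k+1] n k))) (distribʳ _ _ _))) ⟩
    n Cᴿ 0 * h 0 +R Σ≤ R n (λ k → n Cᴿ k * h (suc k) +R n Cᴿ suc k * h (suc k))
      ≈⟨ +-congˡ (Σ≤-distrib-+ n _ _) ⟩
    n Cᴿ 0 * h 0 +R (Σ≤ R n (λ k → n Cᴿ k * h (suc k)) +R Σ≤ R n (λ k → n Cᴿ suc k * h (suc k)))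
      ≈⟨ solve 3 (λ a b c → a :+ (b :+ c) := (a :+ c) :+ b) refl _ _ _ ⟩
    (n Cᴿ 0 * h 0 +R Σ≤ R n (λ k → n Cᴿ suc k * h (suc k))) +R Σ≤ R n (λ k → n Cᴿ k * h (suc k))
      ≈⟨ +-congʳ (Σ≤-suc-head n _) ⟨
    Σ≤ R (suc n) (λ k → n Cᴿ k * h k) +R Σ≤ R n (λ k → n Cᴿ k * h (suc k))
      ≈⟨ +-congʳ (Σ≤-pad (suc n) _ (n≤1+n n) (λ n<k → trans (*-congʳ (k>n⇒nCᴿk≈0 n<k)) (zeroˡ _))) ⟨
    Σ≤ R n (λ k → n Cᴿ k * h k) +R Σ≤ R n (λ k → n Cᴿ k * h (suc k)) ∎

  -- The left-hand side of the identity for the monomials f_N(z) = z ^ N (that is, a = δ₀),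
  -- with the exponent written (m + k) ∸ q; it equals m ∸ q + k only when q ≤ m.
  monomialSum : ℕ → ℕ → ℕ → Carrier → Carrier → Carrier
  monomialSum n m q u z = Σ≤ R n (λ k → n Cᴿ k * ((m + k) Cᴿ q * u ^ (n ∸ k) * z ^ (m + k ∸ q)))

  monomialSum-zero : ∀ m q u z → monomialSum 0 m q u z ≈ m Cᴿ q * z ^ (m ∸ q)
  -- 0 Cᴿ 0 unfolds to 1# +R 0#.
  monomialSum-zero m q u z rewrite ℕₚ.+-identityʳ m =
    solve 2 (λ b w → (con 1 :+ con 0) :* (b :* con 1 :* w) := b :* w) refl (m Cᴿ q) (z ^ (m ∸ q))

  monomialSum-suc : ∀ n m q u z →
                    monomialSum (suc n) m q u z ≈ u * monomialSum n m q u z +R monomialSum n (suc m) q u z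
  monomialSum-suc n m q u z = begin
    monomialSum (suc n) m q u z
      ≈⟨ Σ≤-pascal n (λ k → (m + k) Cᴿ q * u ^ (suc n ∸ k) * z ^ (m + k ∸ q)) ⟩
    Σ≤ R n (λ k → n Cᴿ k * ((m + k) Cᴿ q * u ^ (suc n ∸ k) * z ^ (m + k ∸ q)))
      +R Σ≤ R n (λ k → n Cᴿ k * ((m + suc k) Cᴿ q * u ^ (n ∸ k) * z ^ (m + suc k ∸ q)))
      ≈⟨ +-cong (Σ≤-cong n pull-u) (Σ≤-cong′ n (λ k → reflexive (≡.cong (shifted k) (+-suc m k)))) ⟩
    Σ≤ R n (λ k → u * (n Cᴿ k * ((m + k) Cᴿ q * u ^ (n ∸ k) * z ^ (m + k ∸ q))))
      +R monomialSum n (suc m) q u z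
      ≈⟨ +-congʳ (*-distribˡ-Σ≤ n u _) ⟨
    u * monomialSum n m q u z +R monomialSum n (suc m) q u z ∎
    where
    shifted : ℕ → ℕ → Carrier
    shifted k i = n Cᴿ k * (i Cᴿ q * u ^ (n ∸ k) * z ^ (i ∸ q))
    pull-u : ∀ {k} → k ≤ n →
             n Cᴿ k * ((m + k) Cᴿ q * u ^ (suc n ∸ k) * z ^ (m + k ∸ q))
             ≈ u * (n Cᴿ k * ((m + k) Cᴿ q * u ^ (n ∸ k) * z ^ (m + k ∸ q)))
    pull-u {k} k≤n = begin
      n Cᴿ k * ((m + k) Cᴿ q * u ^ (suc n ∸ k) * z ^ (m + k ∸ q))
        ≡⟨ ≡.cong (λ e → n Cᴿ k * ((m + k) Cᴿ q * u ^ e * z ^ (m + k ∸ q))) (+-∸-assoc 1 k≤n) ⟩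
      n Cᴿ k * ((m + k) Cᴿ q * (u * u ^ (n ∸ k)) * z ^ (m + k ∸ q))
        ≈⟨ solve 5 (λ a b u v w → a :* (b :* (u :* v) :* w) := u :* (a :* (b :* v :* w))) refl
                 (n Cᴿ k) ((m + k) Cᴿ q) u (u ^ (n ∸ k)) (z ^ (m + k ∸ q)) ⟩
      u * (n Cᴿ k * ((m + k) Cᴿ q * u ^ (n ∸ k) * z ^ (m + k ∸ q))) ∎

  monomialSum-suc-zero : ∀ n m u z → monomialSum n (suc m) 0 u z ≈ z * monomialSum n m 0 u z
  monomialSum-suc-zero n m u z = trans (Σ≤-cong′ n pull-z) (sym (*-distribˡ-Σ≤ n z _))
    where
    pull-z : ∀ k → n Cᴿ k * (suc (m + k) Cᴿ 0 * u ^ (n ∸ k) * (z * z ^ (m + k)))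
                   ≈ z * (n Cᴿ k * ((m + k) Cᴿ 0 * u ^ (n ∸ k) * z ^ (m + k)))
    pull-z k = solve 5 (λ a b v z w → a :* (b :* v :* (z :* w)) := z :* (a :* (b :* v :* w))) refl
                     (n Cᴿ k) ((m + k) Cᴿ 0) (u ^ (n ∸ k)) z (z ^ (m + k))

  monomialSum-suc-suc : ∀ n m q u z →
                        monomialSum n (suc m) (suc q) u z ≈ monomialSum n m q u z +R z * monomialSum n m (suc q) u z
  monomialSum-suc-suc n m q u z = begin
    monomialSum n (suc m) (suc q) u z
      ≈⟨ Σ≤-cong′ n split ⟩
    Σ≤ R n (λ k → n Cᴿ k * ((m + k) Cᴿ q * u ^ (n ∸ k) * z ^ (m + k ∸ q))
                   +R z * (n Cᴿ k * ((m + k) Cᴿ suc q * u ^ (n ∸ k) * z ^ (m + k ∸ suc q))))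
      ≈⟨ Σ≤-distrib-+ n _ _ ⟩
    monomialSum n m q u z +R Σ≤ R n (λ k → z * (n Cᴿ k * ((m + k) Cᴿ suc q * u ^ (n ∸ k) * z ^ (m + k ∸ suc q))))
      ≈⟨ +-congˡ (*-distribˡ-Σ≤ n z _) ⟨
    monomialSum n m q u z +R z * monomialSum n m (suc q) u z ∎
    where
    split : ∀ k → n Cᴿ k * (suc (m + k) Cᴿ suc q * u ^ (n ∸ k) * z ^ (m + k ∸ q))
                  ≈ n Cᴿ k * ((m + k) Cᴿ q * u ^ (n ∸ k) * z ^ (m + k ∸ q))
                    +R z * (n Cᴿ k * ((m + k) Cᴿ suc q * u ^ (n ∸ k) * z ^ (m + k ∸ suc q)))
    split k = begin
      a * (suc N Cᴿ suc q * v * z ^ (N ∸ q))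
        ≈⟨ *-congˡ (*-congʳ (*-congʳ (nCᴿk+nCᴿ[k+1]≈[n+1]Cᴿ[k+1] N q))) ⟨
      a * ((N Cᴿ q +R N Cᴿ suc q) * v * z ^ (N ∸ q))
        ≈⟨ solve 5 (λ a b₀ b₁ v w → a :* ((b₀ :+ b₁) :* v :* w) := a :* (b₀ :* v :* w) :+ a :* v :* (b₁ :* w)) refl
                 a (N Cᴿ q) (N Cᴿ suc q) v (z ^ (N ∸ q)) ⟩
      a * (N Cᴿ q * v * z ^ (N ∸ q)) +R a * v * (N Cᴿ suc q * z ^ (N ∸ q))
        ≈⟨ +-congˡ (*-congˡ (nCᴿk*[w*w^[n∸k]]≈nCᴿk*w^[1+n∸k] N (suc q) z)) ⟨
      a * (N Cᴿ q * v * z ^ (N ∸ q)) +R a * v * (N Cᴿ suc q * (z * z ^ (N ∸ suc q)))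
        ≈⟨ +-congˡ (solve 5 (λ a v b z w → a :* v :* (b :* (z :* w)) := z :* (a :* (b :* v :* w))) refl
                          a v (N Cᴿ suc q) z (z ^ (N ∸ suc q))) ⟩
      a * (N Cᴿ q * v * z ^ (N ∸ q)) +R z * (a * (N Cᴿ suc q * v * z ^ (N ∸ suc q))) ∎
      where
      N : ℕ
      N = m + k
      a v : Carrier
      a = n Cᴿ k
      v = u ^ (n ∸ k)

  monomialSum-binomial : ∀ n q u z → monomialSum n 0 q u z ≈ n Cᴿ q * (u +R z) ^ (n ∸ q)
  monomialSum-binomial zero    zero    u z = monomialSum-zero 0 0 u z
  monomialSum-binomial zero    (suc q) u z = monomialSum-zero 0 (suc q) u z
  monomialSum-binomial (suc n) zero    u z = begin
    monomialSum (suc n) 0 0 u z                         ≈⟨ monomialSum-suc n 0 0 u z ⟩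
    u * monomialSum n 0 0 u z +R monomialSum n 1 0 u z  ≈⟨ +-congˡ (monomialSum-suc-zero n 0 u z) ⟩
    u * monomialSum n 0 0 u z +R z * monomialSum n 0 0 u z ≈⟨ distribʳ _ u z ⟨
    (u +R z) * monomialSum n 0 0 u z                    ≈⟨ *-congˡ (monomialSum-binomial n 0 u z) ⟩
    (u +R z) * (n Cᴿ 0 * (u +R z) ^ n)                  ≈⟨ x∙yz≈y∙xz _ _ _ ⟩
    suc n Cᴿ 0 * (u +R z) ^ suc n                       ∎
  monomialSum-binomial (suc n) (suc q) u z = begin
    monomialSum (suc n) 0 (suc q) u z
      ≈⟨ monomialSum-suc n 0 (suc q) u z ⟩
    u * monomialSum n 0 (suc q) u z +R monomialSum n 1 (suc q) u z
      ≈⟨ +-congˡ (monomialSum-suc-suc n 0 q u z) ⟩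
    u * monomialSum n 0 (suc q) u z +R (monomialSum n 0 q u z +R z * monomialSum n 0 (suc q) u z)
      ≈⟨ solve 4 (λ u z s₀ s₁ → u :* s₁ :+ (s₀ :+ z :* s₁) := s₀ :+ (u :+ z) :* s₁) refl u z _ _ ⟩
    monomialSum n 0 q u z +R (u +R z) * monomialSum n 0 (suc q) u z
      ≈⟨ +-cong (monomialSum-binomial n q u z) (*-congˡ (monomialSum-binomial n (suc q) u z)) ⟩
    n Cᴿ q * w ^ (n ∸ q) +R w * (n Cᴿ suc q * w ^ (n ∸ suc q))
      ≈⟨ +-congˡ (x∙yz≈y∙xz _ _ _) ⟩
    n Cᴿ q * w ^ (n ∸ q) +R n Cᴿ suc q * (w * w ^ (n ∸ suc q))
      ≈⟨ +-congˡ (nCᴿk*[w*w^[n∸k]]≈nCᴿk*w^[1+n∸k] n (suc q) w) ⟩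
    n Cᴿ q * w ^ (n ∸ q) +R n Cᴿ suc q * w ^ (n ∸ q)
      ≈⟨ distribʳ _ _ _ ⟨
    (n Cᴿ q +R n Cᴿ suc q) * w ^ (n ∸ q)
      ≈⟨ *-congʳ (nCᴿk+nCᴿ[k+1]≈[n+1]Cᴿ[k+1] n q) ⟩
    suc n Cᴿ suc q * w ^ (n ∸ q) ∎
    where
    w : Carrier
    w = u +R z

  -y+[x+y]≈x : ∀ x y → - y +R (x +R y) ≈ x
  -y+[x+y]≈x x y = begin
    - y +R (x +R y)   ≈⟨ +-congˡ (+-comm x y) ⟩
    - y +R (y +R x)   ≈⟨ +-assoc _ _ _ ⟨
    (- y +R y) +R x   ≈⟨ +-congʳ (-‿inverseˡ y) ⟩
    0# +R x           ≈⟨ +-identityˡ x ⟩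
    x                 ∎

  y*s+[-y*s+t]≈t : ∀ y s t → y * s +R (- y * s +R t) ≈ t
  y*s+[-y*s+t]≈t y s t = begin
    y * s +R (- y * s +R t)   ≈⟨ +-assoc _ _ _ ⟨
    (y * s +R - y * s) +R t   ≈⟨ +-congʳ (distribʳ s y (- y)) ⟨
    (y +R - y) * s +R t       ≈⟨ +-congʳ (trans (*-congʳ (-‿inverseʳ y)) (zeroˡ s)) ⟩
    0# +R t                   ≈⟨ +-identityˡ t ⟩
    t                         ∎

  monomialSum-swap : ∀ n m q x y → monomialSum n m q y x ≈ monomialSum m n q (- y) (x +R y)
  monomialSum-swap zero m q x y = begin
    monomialSum 0 m q y x                        ≈⟨ monomialSum-zero m q y x ⟩
    m Cᴿ q * x ^ (m ∸ q)                         ≈⟨ *-congˡ (^-congˡ (m ∸ q) (-y+[x+y]≈x x y)) ⟨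
    m Cᴿ q * (- y +R (x +R y)) ^ (m ∸ q)         ≈⟨ monomialSum-binomial m q (- y) (x +R y) ⟨
    monomialSum m 0 q (- y) (x +R y)             ∎
  monomialSum-swap (suc n) m q x y = begin
    monomialSum (suc n) m q y x                  ≈⟨ monomialSum-suc n m q y x ⟩
    y * monomialSum n m q y x +R monomialSum n (suc m) q y x
      ≈⟨ +-cong (*-congˡ (monomialSum-swap n m q x y)) (monomialSum-swap n (suc m) q x y) ⟩
    y * s +R monomialSum (suc m) n q (- y) (x +R y)
      ≈⟨ +-congˡ (monomialSum-suc m n q (- y) (x +R y)) ⟩
    y * s +R (- y * s +R monomialSum m (suc n) q (- y) (x +R y))
      ≈⟨ y*s+[-y*s+t]≈t y s _ ⟩
    monomialSum m (suc n) q (- y) (x +R y)       ∎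
    where
    s : Carrier
    s = monomialSum m n q (- y) (x +R y)

  appell-pad : ∀ a {N} M z → N ≤ M → appell R a N z ≈ Σ≤ R M (λ j → N Cᴿ j * a j * z ^ (N ∸ j))
  appell-pad a M z N≤M = Σ≤-pad M _ N≤M (λ N<j → trans (*-congʳ (trans (*-congʳ (k>n⇒nCᴿk≈0 N<j)) (zeroˡ _))) (zeroˡ _))

  appellSum : (ℕ → Carrier) → ℕ → ℕ → ℕ → Carrier → Carrier → Carrier
  appellSum a n m p u z = Σ≤ R n (λ k → n Cᴿ k * (m + k) Cᴿ p * u ^ (n ∸ k) * appell R a (m ∸ p + k) z)

  appellSum≈Σ≤-monomialSum : ∀ a n m p u z → p ≤ m →
    appellSum a n m p u z ≈ Σ≤ R (m + n) (λ j → (p + j) Cᴿ p * a j * monomialSum n m (p + j) u z)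
  appellSum≈Σ≤-monomialSum a n m p u z p≤m = begin
    appellSum a n m p u z
      ≈⟨ Σ≤-cong n (λ k≤n → trans (*-congˡ (appell-pad a (m + n) z (+-mono-≤ (m∸n≤m m p) k≤n))) (*-distribˡ-Σ≤ (m + n) _ _)) ⟩
    Σ≤ R n (λ k → Σ≤ R (m + n) (term k))
      ≈⟨ Σ≤-comm n (m + n) term ⟩
    Σ≤ R (m + n) (λ j → Σ≤ R n (λ k → term k j))
      ≈⟨ Σ≤-cong′ (m + n) (λ j → trans (Σ≤-cong′ n (regroup j)) (sym (*-distribˡ-Σ≤ n _ _))) ⟩
    Σ≤ R (m + n) (λ j → (p + j) Cᴿ p * a j * monomialSum n m (p + j) u z) ∎
    where
    term : ℕ → ℕ → Carrier
    term k j = n Cᴿ k * (m + k) Cᴿ p * u ^ (n ∸ k) * ((m ∸ p + k) Cᴿ j * a j * z ^ (m ∸ p + k ∸ j))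
    regroup : ∀ j k → term k j ≈ (p + j) Cᴿ p * a j * (n Cᴿ k * ((m + k) Cᴿ (p + j) * u ^ (n ∸ k) * z ^ (m + k ∸ (p + j))))
    regroup j k = begin
      term k j
        ≡⟨ ≡.cong (λ i → n Cᴿ k * N Cᴿ p * v * (i Cᴿ j * a j * z ^ (i ∸ j))) (+-∸-comm k p≤m) ⟨
      n Cᴿ k * N Cᴿ p * v * ((N ∸ p) Cᴿ j * a j * z ^ (N ∸ p ∸ j))
        ≈⟨ solve 6 (λ c b₀ v b₁ α w → c :* b₀ :* v :* (b₁ :* α :* w) := b₀ :* b₁ :* (α :* (c :* v :* w))) refl
                 (n Cᴿ k) (N Cᴿ p) v ((N ∸ p) Cᴿ j) (a j) (z ^ (N ∸ p ∸ j)) ⟩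
      N Cᴿ p * (N ∸ p) Cᴿ j * (a j * (n Cᴿ k * v * z ^ (N ∸ p ∸ j)))
        ≈⟨ *-cong (nCᴿp*[n∸p]Cᴿj≈[p+j]Cᴿp*nCᴿ[p+j] N p j) (*-congˡ (*-congˡ (^-congʳ z (∸-+-assoc N p j)))) ⟩
      (p + j) Cᴿ p * N Cᴿ (p + j) * (a j * (n Cᴿ k * v * z ^ (N ∸ (p + j))))
        ≈⟨ solve 6 (λ b₀ b₁ α c v w → b₀ :* b₁ :* (α :* (c :* v :* w)) := b₀ :* α :* (c :* (b₁ :* v :* w))) refl
                 ((p + j) Cᴿ p) (N Cᴿ (p + j)) (a j) (n Cᴿ k) v (z ^ (N ∸ (p + j))) ⟩
      (p + j) Cᴿ p * a j * (n Cᴿ k * (N Cᴿ (p + j) * v * z ^ (N ∸ (p + j)))) ∎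
      where
      N : ℕ
      N = m + k
      v : Carrier
      v = u ^ (n ∸ k)

corollary2 : {c ℓ : Level} (R : CommutativeRing c ℓ) →
    let open CommutativeRing R renaming (_+_ to _+R_) in
    (a : ℕ → Carrier) → a 0 ≈ 1# →
    (n m p : ℕ) → p ≤ n ⊓ m → (x y : Carrier) →
      Σ≤ R n (λ k → binom R n k * binom R (m + k) p * pow R y (n ∸ k) * appell R a (m ∸ p + k) x)
      ≈ Σ≤ R m (λ k → binom R m k * binom R (n + k) p * pow R (- y) (m ∸ k) * appell R a (n ∸ p + k) (x +R y))
corollary2 R a _ n m p p≤n⊓m x y = begin
  appellSum a n m p y x
    ≈⟨ appellSum≈Σ≤-monomialSum a n m p y x (ℕₚ.m≤n⊓o⇒m≤o n m p≤n⊓m) ⟩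
  Σ≤ R (m + n) (λ j → (p + j) Cᴿ p * a j * monomialSum n m (p + j) y x)
    ≈⟨ Σ≤-cong′ (m + n) (λ j → *-congˡ (monomialSum-swap n m (p + j) x y)) ⟩
  Σ≤ R (m + n) swapped
    ≡⟨ ≡.cong (λ N → Σ≤ R N swapped) (ℕₚ.+-comm m n) ⟩
  Σ≤ R (n + m) swapped
    ≈⟨ appellSum≈Σ≤-monomialSum a m n p (- y) (x +R y) (ℕₚ.m≤n⊓o⇒m≤n n m p≤n⊓m) ⟨
  appellSum a m n p (- y) (x +R y) ∎
  where
  open CommutativeRing R renaming (_+_ to _+R_)
  open BinomialSums R
  open import Relation.Binary.Reasoning.Setoid setoid
  swapped : ℕ → Carrier
  swapped j = (p + j) Cᴿ p * a j * monomialSum m n (p + j) (- y) (x +R y)
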